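{- Let $S$ be a semigroup whose minimal left ideals are exactly $I_{i_1},\dots,I_{i_n}$, and suppose $S=I_{i_1}\cup I_{i_2}\cup\cdots\cup I_{i_n}$. Then the clique number of $\mathcal{I}n(S)$ is $\omega(\mathcal{I}n(S))=n-1$.
   Context: A left ideal of a semigroup $S$ is a non-empty subset $I$ with $SI\subseteq I$; it is nontrivial if $I\neq S$ and minimal if it properly contains no left ideal of $S$. The inclusion ideal graph $\mathcal{I}n(S)$ is the simple undirected graph whose vertices are the nontrivial left ideals of $S$, with distinct $I,J$ adjacent iff $I\subset J$ or $J\subset I$. The clique number is the maximum size of a set of pairwise adjacent vertices. -}

module Defs where

open import Level using (Level; _⊔_; suc)
open import Algebra.Bundles using (Semigroup)
open import Data.Nat using (ℕ; _∸_)
open import Data.Fin using (Fin)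
open import Data.Product using (Σ; ∃; _×_; _,_)
open import Data.Sum using (_⊎_)
open import Relation.Nullary using (¬_)
open import Relation.Binary.PropositionalEquality using (_≡_)

-- Subsets of the carrier of S are predicates Carrier → Set (c ⊔ ℓ);
-- a subset must respect the setoid equality of S (this is built into
-- the notion of left ideal below).
module SemigroupIdeals {c ℓ : Level} (S : Semigroup c ℓ) where
  open Semigroup S

  Subset : Set (c ⊔ suc (c ⊔ ℓ))
  Subset = Carrier → Set (c ⊔ ℓ)

  _⊆_ : Subset → Subset → Set (c ⊔ ℓ)
  I ⊆ J = ∀ x → I x → J x

  _≐_ : Subset → Subset → Set (c ⊔ ℓ)
  I ≐ J = (I ⊆ J) × (J ⊆ I)

  _⊂_ : Subset → Subset → Set (c ⊔ ℓ)
  I ⊂ J = (I ⊆ J) × ¬ (J ⊆ I)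

  IsWhole : Subset → Set (c ⊔ ℓ)
  IsWhole I = ∀ x → I x

  record IsLeftIdeal (I : Subset) : Set (c ⊔ ℓ) where
    field
      respects : ∀ {x y} → x ≈ y → I x → I y
      nonempty : ∃ λ x → I x
      absorbs  : ∀ s x → I x → I (s ∙ x)

  IsNontrivialLeftIdeal : Subset → Set (c ⊔ ℓ)
  IsNontrivialLeftIdeal I = IsLeftIdeal I × ¬ IsWhole I

  IsMinimalLeftIdeal : Subset → Set (suc (c ⊔ ℓ))
  IsMinimalLeftIdeal I =
    IsLeftIdeal I × (∀ (K : Subset) → IsLeftIdeal K → K ⊆ I → I ⊆ K)

  -- adjacency in the inclusion ideal graph In(S) (vertices are the
  -- nontrivial left ideals; distinct vertices adjacent iff comparable)
  Adjacent : Subset → Subset → Set (c ⊔ ℓ)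
  Adjacent I J = (I ⊂ J) ⊎ (J ⊂ I)

  record IsClique (k : ℕ) (J : Fin k → Subset) : Set (suc (c ⊔ ℓ)) where
    field
      vertex   : ∀ i → IsNontrivialLeftIdeal (J i)
      distinct : ∀ i j → ¬ i ≡ j → ¬ (J i ≐ J j)
      adjacent : ∀ i j → ¬ i ≡ j → Adjacent (J i) (J j)

  CliqueNumberIs : ℕ → Set (suc (c ⊔ ℓ))
  CliqueNumberIs m =
    (Σ (Fin m → Subset) (IsClique m)) ×
    (∀ k (J : Fin k → Subset) → IsClique k J → k Data.Nat.≤ m)

-- A minimal left ideal K meeting a left ideal L in some x lies inside L,
-- because K ⊆ S x ⊆ L by minimality. Hence distinct minimal left ideals are
-- disjoint, and when I₁, …, Iₙ cover S every left ideal J is the union of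
-- the Iᵢ it contains. For a nontrivial J the index set {i ∣ Iᵢ ⊆ J} has
-- between 1 and n − 1 elements, and a strict inclusion of ideals is a strict
-- inclusion of index sets, so a clique has at most n − 1 vertices. The
-- prefix unions I₁ ∪ ⋯ ∪ Iⱼ for j < n form a clique of exactly that size.
module Submission where

open import Defs
open import Level using (Level)
open import Algebra.Bundles using (Semigroup)
open import Data.Nat using (ℕ; _∸_)
open import Data.Fin using (Fin)
open import Data.Product using (Σ; ∃; _×_)
open import Relation.Nullary using (¬_)
open import Relation.Binary.PropositionalEquality using (_≡_)

open import Data.Bool.Properties using (T-≡)
open import Data.Fin as F using (toℕ; fromℕ; fromℕ<; inject₁; _≟_)
open import Data.Fin.Properties as Fₚ using (injective⇒≤; toℕ-fromℕ<; sequence)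
open import Data.Fin.Subset as FS using (∣_∣)
open import Data.Fin.Subset.Properties as FSₚ using (_∈?_; _⊂?_)
open import Data.Nat using (zero; suc; _≤_; _<_; s≤s; z≤n; pred; _≤?_)
open import Data.Nat.Properties as ℕₚ using (<⇒≤pred; pred[m∸n]≡m∸[1+n])
open import Data.Product using (_,_; proj₁; proj₂)
open import Data.Sum using (inj₁; inj₂)
open import Data.Vec using (tabulate)
open import Data.Vec.Properties using (lookup∘tabulate; lookup⇒[]=; []=⇒lookup)
open import Effect.Monad using (RawMonad)
open import Function using (_∘_; Injective)
open import Function.Bundles using (Equivalence)
open import Relation.Binary using (tri<; tri≈; tri>)
open import Relation.Binary.PropositionalEquality using (refl; sym; trans; cong; subst)
open import Relation.Nullary using (Dec; yes; no; contradiction)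
open import Relation.Nullary.Decidable using (isYes; toWitness; fromWitness; decidable-stable; ¬¬-excluded-middle)
open import Relation.Nullary.Negation using (¬¬-Monad; ¬¬-map)
open import Relation.Unary using (Pred; Decidable)

¬¬-decidable : ∀ {p k n} (P : Fin k → Fin n → Set p) → ¬ ¬ (∀ a i → Dec (P a i))
¬¬-decidable P = sequence ¬¬-applicative λ a → sequence ¬¬-applicative λ i → ¬¬-excluded-middle
  where ¬¬-applicative = RawMonad.rawApplicative ¬¬-Monad

module _ {p n} {P : Pred (Fin n) p} (P? : Decidable P) where

  decSubset : FS.Subset n
  decSubset = tabulate (isYes ∘ P?)

  ∈-decSubset⁺ : ∀ {i} → P i → i FS.∈ decSubset
  ∈-decSubset⁺ {i} Pi = lookup⇒[]= i decSubset
    (trans (lookup∘tabulate (isYes ∘ P?) i) (Equivalence.to T-≡ (fromWitness Pi)))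

  ∈-decSubset⁻ : ∀ {i} → i FS.∈ decSubset → P i
  ∈-decSubset⁻ {i} i∈ = toWitness
    (Equivalence.from T-≡ (trans (sym (lookup∘tabulate (isYes ∘ P?) i)) ([]=⇒lookup i∈)))

⊆∧⊉⇒∣∣< : ∀ {n} {p q : FS.Subset n} → p FS.⊆ q → ¬ q FS.⊆ p → ∣ p ∣ < ∣ q ∣
⊆∧⊉⇒∣∣< {p = p} {q} p⊆q q⊈p with p ⊂? q
... | yes p⊂q = FSₚ.p⊂q⇒∣p∣<∣q∣ p⊂q
... | no  p⊄q = contradiction (λ {i} → q⊆p {i}) q⊈p
  where
  q⊆p : q FS.⊆ p
  q⊆p {i} i∈q with i ∈? p
  ... | yes i∈p = i∈p
  ... | no  i∉p = contradiction ((λ {j} → p⊆q {j}) , i , i∈q , i∉p) p⊄q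

∈⇒0<∣∣ : ∀ {n} {p : FS.Subset n} {i} → i FS.∈ p → 0 < ∣ p ∣
∈⇒0<∣∣ i∈p = ℕₚ.≤-<-trans z≤n (FSₚ.x∈p⇒∣p-x∣<∣p∣ i∈p)

m<n⇒m≤n∸1 : ∀ {m n} → m < n → m ≤ n ∸ 1
m<n⇒m≤n∸1 {m} {n} = subst (m ≤_) (pred[m∸n]≡m∸[1+n] n 0) ∘ <⇒≤pred

0<n≤m⇒pred[n]<m : ∀ {n m} → 0 < n → n ≤ m → pred n < m
0<n≤m⇒pred[n]<m (s≤s z≤n) n≤m = n≤m

injective-into-[1,m]⇒≤ : ∀ {k m} (f : Fin k → ℕ) → (∀ a → 0 < f a) → (∀ a → f a ≤ m) →
  Injective _≡_ _≡_ f → k ≤ m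
injective-into-[1,m]⇒≤ {k} {m} f positive bounded f-injective = injective⇒≤ {f = g} g-injective
  where
  g : Fin k → Fin m
  g a = fromℕ< (0<n≤m⇒pred[n]<m (positive a) (bounded a))

  pred-injective : ∀ {x y} → 0 < x → 0 < y → pred x ≡ pred y → x ≡ y
  pred-injective (s≤s z≤n) (s≤s z≤n) = cong suc

  g-injective : Injective _≡_ _≡_ g
  g-injective {a} {b} ga≡gb = f-injective (pred-injective (positive a) (positive b)
    (trans (sym (toℕ-fromℕ< _)) (trans (cong toℕ ga≡gb) (toℕ-fromℕ< _))))

module LeftIdeals {c ℓ : Level} (S : Semigroup c ℓ) where
  open Semigroup S renaming (refl to ≈-refl; sym to ≈-sym; trans to ≈-trans)
  open SemigroupIdeals S
  open IsLeftIdeal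

  infix 30 S·_
  S·_ : Carrier → Subset
  (S· x) y = ∃ λ s → y ≈ s ∙ x

  S·-isLeftIdeal : ∀ x → IsLeftIdeal (S· x)
  S·-isLeftIdeal x = record
    { respects = λ { y≈z (s , y≈sx) → s , ≈-trans (≈-sym y≈z) y≈sx }
    ; nonempty = x ∙ x , x , ≈-refl
    ; absorbs  = λ { t y (s , y≈sx) → t ∙ s , ≈-trans (∙-congˡ y≈sx) (≈-sym (assoc t s x)) }
    }

  S·-⊆ : ∀ {L x} → IsLeftIdeal L → L x → S· x ⊆ L
  S·-⊆ {x = x} L-ideal x∈L y (s , y≈sx) = respects L-ideal (≈-sym y≈sx) (absorbs L-ideal s x x∈L)

  minimal⊆meetingLeftIdeal : ∀ {K L x} → IsMinimalLeftIdeal K → IsLeftIdeal L → K x → L x → K ⊆ L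
  minimal⊆meetingLeftIdeal {x = x} (K-ideal , K-minimal) L-ideal x∈K x∈L y y∈K =
    S·-⊆ L-ideal x∈L y (K-minimal (S· x) (S·-isLeftIdeal x) (S·-⊆ K-ideal x∈K) y y∈K)

  minimal-meeting⇒≐ : ∀ {K L x} → IsMinimalLeftIdeal K → IsMinimalLeftIdeal L → K x → L x → K ≐ L
  minimal-meeting⇒≐ K-min L-min x∈K x∈L =
    minimal⊆meetingLeftIdeal K-min (proj₁ L-min) x∈K x∈L ,
    minimal⊆meetingLeftIdeal L-min (proj₁ K-min) x∈L x∈K

  ⊂⇒¬≐ : ∀ {J K} → J ⊂ K → ¬ J ≐ K
  ⊂⇒¬≐ (_ , K⊈J) (_ , K⊆J) = K⊈J K⊆J

  adjacent⇒¬≐ : ∀ {J K} → Adjacent J K → ¬ J ≐ K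
  adjacent⇒¬≐ (inj₁ J⊂K) = ⊂⇒¬≐ J⊂K
  adjacent⇒¬≐ (inj₂ K⊂J) (J⊆K , K⊆J) = ⊂⇒¬≐ K⊂J (K⊆J , J⊆K)

  module MinimalFamily {n} (I : Fin n → Subset) (minimal : ∀ i → IsMinimalLeftIdeal (I i)) where

    module Distinct (distinct : ∀ i j → ¬ i ≡ j → ¬ I i ≐ I j) where

      disjoint : ∀ {i j x} → I i x → I j x → i ≡ j
      disjoint {i} {j} x∈Ii x∈Ij with i ≟ j
      ... | yes i≡j = i≡j
      ... | no  i≢j = contradiction (minimal-meeting⇒≐ (minimal i) (minimal j) x∈Ii x∈Ij) (distinct i j i≢j)

      ⋃≤ : Fin n → Subset
      ⋃≤ a x = ∃ λ i → i F.≤ a × I i x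

      ⋃≤-isLeftIdeal : ∀ a → IsLeftIdeal (⋃≤ a)
      ⋃≤-isLeftIdeal a = record
        { respects = λ { x≈y (i , i≤a , x∈Ii) → i , i≤a , respects (Ii-ideal i) x≈y x∈Ii }
        ; nonempty = let (x , x∈Ia) = nonempty (Ii-ideal a) in x , a , ℕₚ.≤-refl , x∈Ia
        ; absorbs  = λ { s x (i , i≤a , x∈Ii) → i , i≤a , absorbs (Ii-ideal i) s x x∈Ii }
        }
        where Ii-ideal = λ i → proj₁ (minimal i)

      ⋃≤-misses : ∀ {a b} → a F.< b → ∀ {x} → I b x → ¬ ⋃≤ a x
      ⋃≤-misses a<b x∈Ib (i , i≤a , x∈Ii) with disjoint x∈Ii x∈Ib
      ... | refl = ℕₚ.<-irrefl refl (ℕₚ.≤-<-trans i≤a a<b)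

      ⋃≤-nontrivial : ∀ {a b} → a F.< b → ¬ IsWhole (⋃≤ a)
      ⋃≤-nontrivial {b = b} a<b whole =
        let (x , x∈Ib) = nonempty (proj₁ (minimal b)) in ⋃≤-misses a<b x∈Ib (whole x)

      ⋃≤-⊂ : ∀ {a b} → a F.< b → ⋃≤ a ⊂ ⋃≤ b
      ⋃≤-⊂ {b = b} a<b =
        (λ { x (i , i≤a , x∈Ii) → i , ℕₚ.≤-trans i≤a (ℕₚ.<⇒≤ a<b) , x∈Ii }) ,
        λ ⋃≤b⊆⋃≤a → let (x , x∈Ib) = nonempty (proj₁ (minimal b)) in
          ⋃≤-misses a<b x∈Ib (⋃≤b⊆⋃≤a x (b , ℕₚ.≤-refl , x∈Ib))

      ⋃≤-adjacent : ∀ a b → ¬ a ≡ b → Adjacent (⋃≤ a) (⋃≤ b)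
      ⋃≤-adjacent a b a≢b with Fₚ.<-cmp a b
      ... | tri< a<b _ _ = inj₁ (⋃≤-⊂ a<b)
      ... | tri≈ _ a≡b _ = contradiction a≡b a≢b
      ... | tri> _ _ b<a = inj₂ (⋃≤-⊂ b<a)

    module Covering (covers : ∀ x → ∃ λ i → I i x) where

      component : Carrier → Fin n
      component x = proj₁ (covers x)

      component⊆ : ∀ {J x} → IsLeftIdeal J → J x → I (component x) ⊆ J
      component⊆ J-ideal x∈J = minimal⊆meetingLeftIdeal (minimal _) J-ideal (proj₂ (covers _)) x∈J

      module Support {J : Subset} (J? : ∀ i → Dec (I i ⊆ J)) where

        support : FS.Subset n
        support = decSubset J?

        0<∣support∣ : IsLeftIdeal J → 0 < ∣ support ∣
        0<∣support∣ J-ideal =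
          let (x , x∈J) = nonempty J-ideal in ∈⇒0<∣∣ (∈-decSubset⁺ J? (component⊆ J-ideal x∈J))

        ∣support∣<n : ¬ IsWhole J → ∣ support ∣ < n
        ∣support∣<n J≠S = ℕₚ.≤∧≢⇒< (FSₚ.∣p∣≤n support) λ ∣support∣≡n →
          J≠S λ x → ∈-decSubset⁻ J? (subst (component x FS.∈_) (sym (FSₚ.∣p∣≡n⇒p≡⊤ ∣support∣≡n)) FSₚ.∈⊤)
                      x (proj₂ (covers x))

      open Support using (support)

      ⊆⇒support-⊆ : ∀ {J K} (J? : ∀ i → Dec (I i ⊆ J)) (K? : ∀ i → Dec (I i ⊆ K)) →
        J ⊆ K → support J? FS.⊆ support K?
      ⊆⇒support-⊆ J? K? J⊆K i∈ = ∈-decSubset⁺ K? λ x x∈Ii → J⊆K x (∈-decSubset⁻ J? i∈ x x∈Ii)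

      support-⊆⇒⊆ : ∀ {J K} (J? : ∀ i → Dec (I i ⊆ J)) (K? : ∀ i → Dec (I i ⊆ K)) →
        IsLeftIdeal J → support J? FS.⊆ support K? → J ⊆ K
      support-⊆⇒⊆ J? K? J-ideal supp⊆ x x∈J =
        ∈-decSubset⁻ K? (supp⊆ (∈-decSubset⁺ J? (component⊆ J-ideal x∈J))) x (proj₂ (covers x))

      ⊂⇒∣support∣< : ∀ {J K} (J? : ∀ i → Dec (I i ⊆ J)) (K? : ∀ i → Dec (I i ⊆ K)) →
        IsLeftIdeal K → J ⊂ K → ∣ support J? ∣ < ∣ support K? ∣
      ⊂⇒∣support∣< J? K? K-ideal (J⊆K , K⊈J) =
        ⊆∧⊉⇒∣∣< (⊆⇒support-⊆ J? K? J⊆K) (K⊈J ∘ support-⊆⇒⊆ K? J? K-ideal)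

      adjacent⇒∣support∣≢ : ∀ {J K} (J? : ∀ i → Dec (I i ⊆ J)) (K? : ∀ i → Dec (I i ⊆ K)) →
        IsLeftIdeal J → IsLeftIdeal K → Adjacent J K → ¬ ∣ support J? ∣ ≡ ∣ support K? ∣
      adjacent⇒∣support∣≢ J? K? _ K-ideal (inj₁ J⊂K) = ℕₚ.<⇒≢ (⊂⇒∣support∣< J? K? K-ideal J⊂K)
      adjacent⇒∣support∣≢ J? K? J-ideal _ (inj₂ K⊂J) = ℕₚ.<⇒≢ (⊂⇒∣support∣< K? J? J-ideal K⊂J) ∘ sym

      -- Whether Iᵢ ⊆ J holds is not decidable, but k ≤ n ∸ 1 is, so the
      -- supports may be formed under a double negation.
      clique-size≤ : ∀ k (J : Fin k → Subset) → IsClique k J → k ≤ n ∸ 1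
      clique-size≤ k J clique =
        decidable-stable (k ≤? n ∸ 1) (¬¬-map bound (¬¬-decidable λ a i → I i ⊆ J a))
        where
        open IsClique clique

        ideal : ∀ a → IsLeftIdeal (J a)
        ideal a = proj₁ (vertex a)

        bound : (∀ a i → Dec (I i ⊆ J a)) → k ≤ n ∸ 1
        bound J? = injective-into-[1,m]⇒≤ size
          (λ a → Support.0<∣support∣ (J? a) (ideal a))
          (λ a → m<n⇒m≤n∸1 (Support.∣support∣<n (J? a) (proj₂ (vertex a))))
          size-injective
          where
          size : Fin k → ℕ
          size a = ∣ support (J? a) ∣

          size-injective : Injective _≡_ _≡_ size
          size-injective {a} {b} size≡ with a ≟ b
          ... | yes a≡b = a≡b
          ... | no  a≢b = contradiction size≡
                  (adjacent⇒∣support∣≢ (J? a) (J? b) (ideal a) (ideal b) (adjacent a b a≢b))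

  prefixUnions-clique : ∀ n (I : Fin n → Subset) → (∀ i → IsMinimalLeftIdeal (I i)) →
    (∀ i j → ¬ i ≡ j → ¬ I i ≐ I j) → Σ (Fin (n ∸ 1) → Subset) (IsClique (n ∸ 1))
  prefixUnions-clique zero I _ _ = (λ ()) , record { vertex = λ () ; distinct = λ () ; adjacent = λ () }
  prefixUnions-clique (suc m) I minimal distinct = ⋃≤ ∘ inject₁ , record
    { vertex   = λ a → ⋃≤-isLeftIdeal (inject₁ a) , ⋃≤-nontrivial (inject₁<fromℕ a)
    ; distinct = λ a b a≢b → adjacent⇒¬≐ (adjacent a b a≢b)
    ; adjacent = adjacent
    }
    where
    open MinimalFamily.Distinct I minimal distinct

    inject₁<fromℕ : ∀ a → inject₁ a F.< fromℕ m
    inject₁<fromℕ a = subst (toℕ (inject₁ a) <_) (sym (Fₚ.toℕ-fromℕ m)) (Fₚ.inject₁ℕ< a)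

    adjacent : ∀ a b → ¬ a ≡ b → Adjacent (⋃≤ (inject₁ a)) (⋃≤ (inject₁ b))
    adjacent a b a≢b = ⋃≤-adjacent (inject₁ a) (inject₁ b) (a≢b ∘ Fₚ.inject₁-injective)

mainTheorem14 : ∀ {c ℓ : Level} (S : Semigroup c ℓ) (n : ℕ)
    (I : Fin n → SemigroupIdeals.Subset S) →
    (∀ i → SemigroupIdeals.IsMinimalLeftIdeal S (I i)) →
    (∀ i j → ¬ i ≡ j → ¬ SemigroupIdeals._≐_ S (I i) (I j)) →
    (∀ (K : SemigroupIdeals.Subset S) → SemigroupIdeals.IsMinimalLeftIdeal S K →
    ∃ λ i → SemigroupIdeals._≐_ S K (I i)) →
    (∀ (x : Semigroup.Carrier S) → ∃ λ i → I i x) →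
    SemigroupIdeals.CliqueNumberIs S (n ∸ 1)
mainTheorem14 S n I minimal distinct _ covers =
  prefixUnions-clique n I minimal distinct , clique-size≤
  where
  open LeftIdeals S
  open MinimalFamily.Covering I minimal covers using (clique-size≤)
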